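{- There exists a bidimensional infinite word that is uniformly recurrent (UR) but not URD.
   Context: $\mathbb{N}=\{0,1,\ldots\}$. For $w\colon\mathbb{N}^2\to A$, a finite word $f$ of size $(s_1,s_2)$ is a factor at position $\mathbf{p}$ if $f(\mathbf{i})=w(\mathbf{p}+\mathbf{i})$ for all $\mathbf{i}\in\{0,\ldots,s_1-1\}\times\{0,\ldots,s_2-1\}$; a prefix if $\mathbf{p}=(0,0)$. $w$ is UR if for every prefix $p$ there is $b$ such that every factor of size $(b,b)$ contains $p$ as a factor. A direction is $\mathbf{q}\in\mathbb{N}^2$ with coprime nonnegative entries; $w_{\mathbf{q},\mathbf{s}}$ is the one-dimensional word whose $\ell$-th letter is the block $\mathbf{i}\mapsto w(\mathbf{i}+\ell\mathbf{q})$ of size $\mathbf{s}$. $w$ is URD if for all $\mathbf{s}$ and all directions $\mathbf{q}$ there is $b$ such that every length-$b$ factor of $w_{\mathbf{q},\mathbf{s}}$ contains $w_{\mathbf{q},\mathbf{s}}(0)$. -}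

module Defs where

open import Data.Nat using (ℕ; _+_; _*_; _≤_; _<_)
open import Data.Nat.Coprimality using (Coprime)
open import Data.Product using (Σ; ∃; _×_)
open import Relation.Binary.PropositionalEquality using (_≡_)

Word2 : Set → Set
Word2 A = ℕ → ℕ → A

PrefixAt : {A : Set} → Word2 A → ℕ → ℕ → ℕ → ℕ → Set
PrefixAt w s₁ s₂ r₁ r₂ =
  ∀ i j → i < s₁ → j < s₂ → w (r₁ + i) (r₂ + j) ≡ w i j

UR : {A : Set} → Word2 A → Set
UR w = ∀ s₁ s₂ → ∃ λ b → ∀ q₁ q₂ → ∃ λ r₁ → ∃ λ r₂ →
  (q₁ ≤ r₁) × (r₁ + s₁ ≤ q₁ + b) × (q₂ ≤ r₂) × (r₂ + s₂ ≤ q₂ + b) ×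
  PrefixAt w s₁ s₂ r₁ r₂

Direction : ℕ → ℕ → Set
Direction q₁ q₂ = Coprime q₁ q₂

-- The ℓ-th letter of w_{q,s} equals its 0-th letter.
-- (w_{q,s}(ℓ) is the block i ↦ w(i + ℓ q) of size s; w_{q,s}(0) is the prefix.)
LetterEqFirst : {A : Set} → Word2 A → ℕ → ℕ → ℕ → ℕ → ℕ → Set
LetterEqFirst w s₁ s₂ q₁ q₂ ℓ = PrefixAt w s₁ s₂ (ℓ * q₁) (ℓ * q₂)

URD : {A : Set} → Word2 A → Set
URD w = ∀ s₁ s₂ q₁ q₂ → Direction q₁ q₂ → ∃ λ b → ∀ m → ∃ λ ℓ →
  (m ≤ ℓ) × (ℓ < m + b) × LetterEqFirst w s₁ s₂ q₁ q₂ ℓ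

-- The witness is w x y = [ν₂ x = ν₂ y], where ν₂ is the 2-adic valuation
-- and ν₂ 0 = ∞. It is not URD because w ℓ 0 = 0 for every ℓ ≥ 1, while
-- w 0 0 = 1: the first letter never comes back along the direction (1,0).
-- It is UR because adding 2^K u with u odd to both coordinates does not
-- change ν₂ of numbers below 2^K (and sends 0 to valuation K on both sides),
-- so the prefix of size 2^K reappears at (2^K u, 2^K v) for all odd u, v,
-- and every square of side 3 · 2^K contains such a position.
module Submission where

open import Defs
open import Data.Nat using (ℕ)
open import Data.Fin using (Fin)
open import Data.Product using (Σ; _×_)
open import Relation.Nullary using (¬_)

open import Data.Bool using (Bool; true; false)
open import Data.Fin.Properties as Fin using (2↔Bool)
open import Function.Bundles using (Inverse)
open import Data.Nat
  using (zero; suc; _+_; _*_; _^_; _⊔_; _≤_; _<_; z≤n; s≤s; ⌊_/2⌋; ⌈_/2⌉; parity)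
open import Data.Nat.Coprimality using (1-coprimeTo)
open import Data.Nat.Induction using (<-rec)
open import Data.Nat.Properties
open import Data.Parity.Base as ℙ using (Parity; 0ℙ; 1ℙ)
open import Data.Parity.Properties using (+-homo-+; *-homo-*)
open import Data.Product using (_,_; ∃)
open import Data.Sum using (inj₁; inj₂)
open import Relation.Binary.PropositionalEquality
  using (_≡_; refl; sym; trans; cong; cong₂; module ≡-Reasoning)

n≤1+m⇒⌊n/2⌋≤m : ∀ {n m} → n ≤ suc m → ⌊ n /2⌋ ≤ m
n≤1+m⇒⌊n/2⌋≤m {m = m} n≤1+m = ≤-trans (⌊n/2⌋-mono n≤1+m) (≤-pred (⌊n/2⌋<n m))

n<2*m⇒⌊n/2⌋<m : ∀ {n m} → n < 2 * m → ⌊ n /2⌋ < m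
n<2*m⇒⌊n/2⌋<m {n} {m} n<2m = *-cancelˡ-< 2 ⌊ n /2⌋ m (begin-strict
  2 * ⌊ n /2⌋          ≡⟨ cong (⌊ n /2⌋ +_) (+-identityʳ ⌊ n /2⌋) ⟩
  ⌊ n /2⌋ + ⌊ n /2⌋    ≤⟨ +-monoʳ-≤ ⌊ n /2⌋ (⌊n/2⌋≤⌈n/2⌉ n) ⟩
  ⌊ n /2⌋ + ⌈ n /2⌉    ≡⟨ ⌊n/2⌋+⌈n/2⌉≡n n ⟩
  n                    <⟨ n<2m ⟩
  2 * m                ∎)
  where open ≤-Reasoning

⌊2*m+n/2⌋≡m+⌊n/2⌋ : ∀ m n → ⌊ 2 * m + n /2⌋ ≡ m + ⌊ n /2⌋
⌊2*m+n/2⌋≡m+⌊n/2⌋ zero    n = refl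
⌊2*m+n/2⌋≡m+⌊n/2⌋ (suc m) n rewrite +-suc m (m + 0) = cong suc (⌊2*m+n/2⌋≡m+⌊n/2⌋ m n)

parity[2*m+n]≡parity[n] : ∀ m n → parity (2 * m + n) ≡ parity n
parity[2*m+n]≡parity[n] m n =
  trans (+-homo-+ (2 * m) n) (cong (ℙ._+ parity n) (*-homo-* 2 m))

n<2^n : ∀ n → n < 2 ^ n
n<2^n zero    = s≤s z≤n
n<2^n (suc n) = begin-strict
  suc n            ≡⟨ +-comm 1 n ⟩
  n + 1            <⟨ +-mono-<-≤ (n<2^n n) (m^n>0 2 n) ⟩
  2 ^ n + 2 ^ n    ≡⟨ cong (2 ^ n +_) (+-identityʳ (2 ^ n)) ⟨
  2 ^ suc n        ∎
  where open ≤-Reasoning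

lowBitStep : Parity → Parity → Bool → Bool
lowBitStep 0ℙ 0ℙ b = b
lowBitStep 1ℙ 1ℙ _ = true
lowBitStep _  _  _ = false

sameValuationWithin : ℕ → ℕ → ℕ → Bool
sameValuationWithin zero    _ _ = true
sameValuationWithin (suc f) x y =
  lowBitStep (parity x) (parity y) (sameValuationWithin f ⌊ x /2⌋ ⌊ y /2⌋)

sameValuationWithin-irrelevant : ∀ {f g x y} → x ≤ f → y ≤ f → x ≤ g → y ≤ g →
  sameValuationWithin f x y ≡ sameValuationWithin g x y
sameValuationWithin-irrelevant {zero}  {zero}  _   _   _   _   = refl
sameValuationWithin-irrelevant {zero}  {suc g} z≤n z≤n _   _   =
  sameValuationWithin-irrelevant {zero} {g} z≤n z≤n z≤n z≤n
sameValuationWithin-irrelevant {suc f} {zero}  _   _   z≤n z≤n =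
  sameValuationWithin-irrelevant {f} {zero} z≤n z≤n z≤n z≤n
sameValuationWithin-irrelevant {suc f} {suc g} {x} {y} x≤f y≤f x≤g y≤g =
  cong (lowBitStep (parity x) (parity y))
    (sameValuationWithin-irrelevant
      (n≤1+m⇒⌊n/2⌋≤m x≤f) (n≤1+m⇒⌊n/2⌋≤m y≤f) (n≤1+m⇒⌊n/2⌋≤m x≤g) (n≤1+m⇒⌊n/2⌋≤m y≤g))

-- True iff ν₂ x = ν₂ y, with ν₂ 0 = ∞: the binary expansions are compared
-- from the lowest bit, and x ⊔ y steps always suffice to reach a decision.
sameValuation : ℕ → ℕ → Bool
sameValuation x y = sameValuationWithin (x ⊔ y) x y

sameValuation-unfold : ∀ x y →
  sameValuation x y ≡ lowBitStep (parity x) (parity y) (sameValuation ⌊ x /2⌋ ⌊ y /2⌋)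
sameValuation-unfold x y = trans
  (sameValuationWithin-irrelevant x≤x⊔y y≤x⊔y (m≤n⇒m≤1+n x≤x⊔y) (m≤n⇒m≤1+n y≤x⊔y))
  (cong (lowBitStep (parity x) (parity y))
    (sameValuationWithin-irrelevant
      (≤-trans (⌊n/2⌋≤n x) x≤x⊔y) (≤-trans (⌊n/2⌋≤n y) y≤x⊔y)
      (m≤m⊔n ⌊ x /2⌋ ⌊ y /2⌋) (m≤n⊔m ⌊ x /2⌋ ⌊ y /2⌋)))
  where
  x≤x⊔y : x ≤ x ⊔ y
  x≤x⊔y = m≤m⊔n x y
  y≤x⊔y : y ≤ x ⊔ y
  y≤x⊔y = m≤n⊔m x y

sameValuation-odd : ∀ {x y} → parity x ≡ 1ℙ → parity y ≡ 1ℙ → sameValuation x y ≡ true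
sameValuation-odd {x} {y} px py rewrite sameValuation-unfold x y | px | py = refl

sameValuation-suc-zero : ∀ n → sameValuation (suc n) 0 ≡ false
sameValuation-suc-zero = <-rec _ step
  where
  step : ∀ n → (∀ {m} → m < n → sameValuation (suc m) 0 ≡ false) →
         sameValuation (suc n) 0 ≡ false
  step zero    _   = sameValuation-unfold 1 0
  step (suc n) rec rewrite sameValuation-unfold (suc (suc n)) 0 with parity n
  ... | 0ℙ = rec (s≤s (⌊n/2⌋≤n n))
  ... | 1ℙ = refl

sameValuation-2*+ : ∀ m n i j → sameValuation (2 * m + i) (2 * n + j) ≡
  lowBitStep (parity i) (parity j) (sameValuation (m + ⌊ i /2⌋) (n + ⌊ j /2⌋))
sameValuation-2*+ m n i j
  rewrite sameValuation-unfold (2 * m + i) (2 * n + j)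
        | parity[2*m+n]≡parity[n] m i | parity[2*m+n]≡parity[n] n j
        | ⌊2*m+n/2⌋≡m+⌊n/2⌋ m i | ⌊2*m+n/2⌋≡m+⌊n/2⌋ n j = refl

sameValuation-shift : ∀ K {u v i j} → parity u ≡ 1ℙ → parity v ≡ 1ℙ →
  i < 2 ^ K → j < 2 ^ K →
  sameValuation (2 ^ K * u + i) (2 ^ K * v + j) ≡ sameValuation i j
sameValuation-shift zero {u} {v} pu pv (s≤s z≤n) (s≤s z≤n)
  rewrite +-identityʳ (1 * u) | +-identityʳ (1 * v) | *-identityˡ u | *-identityˡ v =
  sameValuation-odd {u} {v} pu pv
sameValuation-shift (suc K) {u} {v} {i} {j} pu pv i< j< = begin
  sameValuation (2 ^ suc K * u + i) (2 ^ suc K * v + j)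
    ≡⟨ cong₂ sameValuation (cong (_+ i) (*-assoc 2 (2 ^ K) u))
                           (cong (_+ j) (*-assoc 2 (2 ^ K) v)) ⟩
  sameValuation (2 * (2 ^ K * u) + i) (2 * (2 ^ K * v) + j)
    ≡⟨ sameValuation-2*+ (2 ^ K * u) (2 ^ K * v) i j ⟩
  lowBitStep (parity i) (parity j)
    (sameValuation (2 ^ K * u + ⌊ i /2⌋) (2 ^ K * v + ⌊ j /2⌋))
    ≡⟨ cong (lowBitStep (parity i) (parity j))
         (sameValuation-shift K pu pv (n<2*m⇒⌊n/2⌋<m i<) (n<2*m⇒⌊n/2⌋<m j<)) ⟩
  lowBitStep (parity i) (parity j) (sameValuation ⌊ i /2⌋ ⌊ j /2⌋)
    ≡⟨ sameValuation-unfold i j ⟨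
  sameValuation i j ∎
  where open ≡-Reasoning

oddMultiple-between : ∀ {M} → 0 < M → ∀ q →
  ∃ λ u → parity u ≡ 1ℙ × q ≤ M * u × M * u ≤ q + 2 * M
oddMultiple-between {M} 0<M zero =
  1 , refl , z≤n , ≤-trans (≤-reflexive (*-identityʳ M)) (m≤m+n M (M + 0))
oddMultiple-between {M} 0<M (suc q) with oddMultiple-between 0<M q
... | u , pu , q≤Mu , Mu≤q+2M with m≤n⇒m<n∨m≡n q≤Mu
...   | inj₁ q<Mu = u , pu , q<Mu , ≤-trans Mu≤q+2M (+-monoˡ-≤ (2 * M) (n≤1+n q))
...   | inj₂ refl = 2 + u , pu ,
  ≤-trans (m<m+n (M * u) (≤-trans 0<M (m≤m+n M (M + 0)))) (≤-reflexive (sym M*[2+u])) ,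
  ≤-trans (≤-reflexive M*[2+u]) (+-monoˡ-≤ (2 * M) (n≤1+n (M * u)))
  where
  M*[2+u] : M * (2 + u) ≡ M * u + 2 * M
  M*[2+u] = trans (*-distribˡ-+ M 2 u)
                  (trans (+-comm (M * 2) (M * u)) (cong (M * u +_) (*-comm M 2)))

valuationWord : Word2 (Fin 2)
valuationWord x y = Inverse.from 2↔Bool (sameValuation x y)

valuationWord-UR : UR valuationWord
valuationWord-UR s₁ s₂ = 2 * M + M , λ q₁ q₂ →
  let u , pu , q₁≤Mu , Mu≤q₁+2M = oddMultiple-between (m^n>0 2 K) q₁
      v , pv , q₂≤Mv , Mv≤q₂+2M = oddMultiple-between (m^n>0 2 K) q₂
  in M * u , M * v , q₁≤Mu , fits q₁ Mu≤q₁+2M s₁≤M , q₂≤Mv , fits q₂ Mv≤q₂+2M s₂≤M ,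
     λ i j i<s₁ j<s₂ → cong (Inverse.from 2↔Bool)
       (sameValuation-shift K pu pv (<-≤-trans i<s₁ s₁≤M) (<-≤-trans j<s₂ s₂≤M))
  where
  K : ℕ
  K = s₁ + s₂
  M : ℕ
  M = 2 ^ K
  s₁≤M : s₁ ≤ M
  s₁≤M = ≤-trans (m≤m+n s₁ s₂) (<⇒≤ (n<2^n K))
  s₂≤M : s₂ ≤ M
  s₂≤M = ≤-trans (m≤n+m s₂ s₁) (<⇒≤ (n<2^n K))
  fits : ∀ q {r s} → r ≤ q + 2 * M → s ≤ M → r + s ≤ q + (2 * M + M)
  fits q r≤ s≤ = ≤-trans (+-mono-≤ r≤ s≤) (≤-reflexive (+-assoc q (2 * M) M))

valuationWord-¬URD : ¬ URD valuationWord
valuationWord-¬URD urd with urd 1 1 1 0 (1-coprimeTo 0)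
... | _ , returns with returns 1
... | suc ℓ , _ , _ , back =
  Fin.0≢1+n (trans (cong (Inverse.from 2↔Bool) (sym sameValuation[1+ℓ,0]≡false))
                   (back 0 0 (s≤s z≤n) (s≤s z≤n)))
  where
  sameValuation[1+ℓ,0]≡false : sameValuation (suc ℓ * 1 + 0) (suc ℓ * 0 + 0) ≡ false
  sameValuation[1+ℓ,0]≡false = trans
    (cong₂ sameValuation (trans (+-identityʳ _) (*-identityʳ (suc ℓ)))
                         (trans (+-identityʳ _) (*-zeroʳ (suc ℓ))))
    (sameValuation-suc-zero ℓ)

corollary3p5 : Σ ℕ λ k → Σ (Word2 (Fin k)) λ w → UR w × ¬ URD w
corollary3p5 = 2 , valuationWord , valuationWord-UR , valuationWord-¬URD
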